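{- Let $p\le q$ be $n$-symmetric lattice paths. Let $M[p,q]$ be the matroid on ground set $[\pm n]$ whose bases are the sets of labels of the $E$ steps of all (not necessarily symmetric) lattice paths $r$ from $(0,0)$ to $(n,n)$ with $p\le r\le q$, where steps are labelled in order by $-n,-(n-1),\dots,-1,1,\dots,n$. Let $\pi:\mathbb{R}^{[\pm n]}\to\mathbb{R}^n$ be $\pi(x)_i=\tfrac12(x_i-x_{ -i}+1)$ for $i\in[n]$. Then $\pi(P(M[p,q]))=P(\Delta[p,q])$, i.e. $M[p,q]$ is an enveloping matroid of the Lagrangian matroid of $[p,q]$.
   Context: An $n$-symmetric lattice path is a path from $(0,0)$ to $(n,n)$ of $2n$ unit steps $E=(1,0)$, $N=(0,1)$, a word $\alpha_1\cdots\alpha_{2n}$ with $\alpha_i\ne\alpha_{2n-i+1}$ for $i\le n$. For lattice paths, $p\le r$ means $p$ lies weakly below $r$. $\operatorname{lab}^L(r)$ is the set of labels of $E$ steps when steps are labelled in order by $-n,\dots,-1,1,\dots,n$. $\Delta[p,q]$ is the delta matroid on $[n]$ with feasible sets $\operatorname{lab}^L(r)\cap[n]$ for symmetric $r$ with $p\le r\le q$, and $P(\Delta[p,q])\subseteq\mathbb{R}^n$ the convex hull of their indicator vectors. $P(M)$ is the convex hull of indicator vectors of bases of $M$ in $\mathbb{R}^{[\pm n]}$.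
   Formalization: The polytopes $P(M[p,q])$ and $P(\Delta[p,q])$ and the map π are taken over the rationals instead of the reals, with rational coordinates and rational convex-combination weights. -}

module Defs where

open import Data.Nat as ℕ using (ℕ; zero; suc)
open import Data.Bool using (Bool; true; false)
open import Data.Fin using (Fin; _↑ʳ_; _↑ˡ_; opposite)
open import Data.Vec using (Vec; lookup; toList)
open import Data.List using (List; []; _∷_; take; map; foldr)
open import Data.Rational as ℚ using (ℚ; 0ℚ; 1ℚ; ½)
open import Data.Product using (Σ; _×_; _,_; proj₁; proj₂)
open import Data.List.Relation.Unary.All using (All)
open import Relation.Binary.PropositionalEquality using (_≡_; _≢_)

-- A word in {E,N} of length 2n; true = E = (1,0), false = N = (0,1).
-- Position k (0-based, k : Fin (n + n)) carries label -(n-k) if k < n and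
-- label k-n+1 if k ≥ n.  So label i ∈ [n] sits at position  n ↑ʳ (i-1)
-- and label -i sits at position  opposite (n ↑ʳ (i-1)).
Word : ℕ → Set
Word n = Vec Bool (n ℕ.+ n)

countE : List Bool → ℕ
countE []           = 0
countE (true ∷ w)  = suc (countE w)
countE (false ∷ w) = countE w

countN : List Bool → ℕ
countN []           = 0
countN (true ∷ w)  = countN w
countN (false ∷ w) = suc (countN w)

-- lattice path from (0,0) to (n,n): exactly n E steps (hence n N steps)
IsLatticePath : ∀ {n} → Word n → Set
IsLatticePath {n} w = countE (toList w) ≡ n

-- n-symmetric: α_i ≠ α_{2n-i+1} for 1 ≤ i ≤ n
IsSymmetric : ∀ {n} → Word n → Set
IsSymmetric {n} w = (i : Fin n) → lookup w (i ↑ˡ n) ≢ lookup w (opposite (i ↑ˡ n))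

_≤P_ : ∀ {n} → Word n → Word n → Set
p ≤P r = (k : ℕ) → countN (take k (toList p)) ℕ.≤ countN (take k (toList r))

ind : Bool → ℚ
ind true  = 1ℚ
ind false = 0ℚ

-- indicator vector of lab^L(r) in ℚ^{[±n]} (coordinates indexed by positions)
labVec : ∀ {n} → Word n → (Fin (n ℕ.+ n) → ℚ)
labVec r k = ind (lookup r k)

-- indicator vector of lab^L(r) ∩ [n] in ℚ^n (coordinate j ↔ label j+1)
labPosVec : ∀ {n} → Word n → (Fin n → ℚ)
labPosVec {n} r j = ind (lookup r (n ↑ʳ j))

sumℚ : List ℚ → ℚ
sumℚ = foldr ℚ._+_ 0ℚ

InHull : ∀ {d} → ((Fin d → ℚ) → Set) → (Fin d → ℚ) → Set
InHull {d} S x =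
  Σ (List (ℚ × (Fin d → ℚ))) λ cs →
    All (λ cv → (0ℚ ℚ.≤ proj₁ cv) × S (proj₂ cv)) cs
    × sumℚ (map proj₁ cs) ≡ 1ℚ
    × ((i : Fin d) → sumℚ (map (λ cv → proj₁ cv ℚ.* proj₂ cv i) cs) ≡ x i)

IsBasisVecM : ∀ {n} → Word n → Word n → (Fin (n ℕ.+ n) → ℚ) → Set
IsBasisVecM {n} p q y = Σ (Word n) λ r → IsLatticePath {n} r × _≤P_ {n} p r × _≤P_ {n} r q × ((k : Fin (n ℕ.+ n)) → y k ≡ labVec {n} r k)

IsFeasibleVecΔ : ∀ {n} → Word n → Word n → (Fin n → ℚ) → Set
IsFeasibleVecΔ {n} p q x = Σ (Word n) λ r → IsLatticePath {n} r × IsSymmetric {n} r × _≤P_ {n} p r × _≤P_ {n} r q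
                                   × ((j : Fin n) → x j ≡ labPosVec {n} r j)

PM : ∀ {n} → Word n → Word n → (Fin (n ℕ.+ n) → ℚ) → Set
PM {n} p q = InHull (IsBasisVecM {n} p q)

PΔ : ∀ {n} → Word n → Word n → (Fin n → ℚ) → Set
PΔ {n} p q = InHull (IsFeasibleVecΔ {n} p q)

π : ∀ {n} → (Fin (n ℕ.+ n) → ℚ) → (Fin n → ℚ)
π {n} y j = ((y (n ↑ʳ j) ℚ.- y (opposite (n ↑ʳ j))) ℚ.+ 1ℚ) ℚ.* ½

Image-π : ∀ {n} → ((Fin (n ℕ.+ n) → ℚ) → Set) → (Fin n → ℚ) → Set
Image-π {n} S x = Σ (Fin (n ℕ.+ n) → ℚ) λ y → S y × ((j : Fin n) → π {n} y j ≡ x j)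

-- A lattice path is symmetric exactly when it is invariant under the
-- reflection of the square in its anti-diagonal.  Every path r of M[p,q]
-- yields two symmetric paths: keep the first half of r and complete it by its
-- mirror image, or keep the second half and precede it by its mirror image.
-- Both operations are monotone for "weakly below" and fix symmetric paths, so
-- they map [p,q] into its symmetric part.  Coordinate i of π at the indicator
-- vector of r is the average of the i-th indicators of the two
-- symmetrizations, and at a symmetric path π returns its own indicator vector.
-- As π is affine, both facts pass to convex hulls.

module Submission where

open import Defs
open import Data.Bool using (Bool; true; false; not; if_then_else_)
open import Data.Bool.Properties using (not-involutive; ¬-not; not-¬)
open import Data.Fin using (Fin; toℕ; fromℕ<; _↑ˡ_; _↑ʳ_; opposite)
open import Data.Fin.Properties using (toℕ-↑ˡ; toℕ-↑ʳ; toℕ-fromℕ<; toℕ<n; opposite-prop)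
open import Data.List using (List; []; _∷_; map; take)
open import Data.List.Relation.Unary.All using (All; []; _∷_)
open import Data.Nat
  using (ℕ; zero; suc; _+_; _∸_; _≤_; _<_; _⊓_; _≤′_; ≤′-refl; ≤′-step; _<?_; _≤?_; s≤s)
open import Data.Nat.Properties
open import Algebra.Properties.CommutativeSemigroup +-commutativeSemigroup using (xy∙z≈xz∙y)
open import Data.Product using (Σ; ∃₂; _×_; _,_; proj₁; proj₂)
open import Data.Rational as ℚ using (ℚ; 0ℚ; 1ℚ; ½)
open import Data.Rational.Properties using (*-monoʳ-≤-nonNeg)
open import Data.Vec using (Vec; []; _∷_; lookup; tabulate; toList)
open import Data.Vec.Properties using (lookup∘tabulate; length-toList)
open import Data.List.Properties using (take-all)
open import Function using (_∘_)
open import Relation.Binary.PropositionalEquality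
open import Relation.Nullary using (does; yes; no)
open import Relation.Nullary.Decidable using (dec-true; dec-false)

-- Heights of step sequences

north : Bool → ℕ
north true  = 0
north false = 1

height : (ℕ → Bool) → ℕ → ℕ
height f zero    = 0
height f (suc k) = height f k + north (f k)

height-suc : ∀ f k → height f (suc k) ≡ north (f 0) + height (f ∘ suc) k
height-suc f zero    = +-comm 0 (north (f 0))
height-suc f (suc k) =
  trans (cong (_+ north (f (suc k))) (height-suc f k)) (+-assoc (north (f 0)) _ _)

Agree : ℕ → (ℕ → Bool) → (ℕ → Bool) → Set
Agree L f g = ∀ i → i < L → f i ≡ g i

Agree-sym : ∀ {L f g} → Agree L f g → Agree L g f
Agree-sym f≐g i i<L = sym (f≐g i i<L)

Agree-trans : ∀ {L f g h} → Agree L f g → Agree L g h → Agree L f h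
Agree-trans f≐g g≐h i i<L = trans (f≐g i i<L) (g≐h i i<L)

height-cong : ∀ {L f g} → Agree L f g → ∀ {k} → k ≤ L → height f k ≡ height g k
height-cong f≐g {zero}  _   = refl
height-cong f≐g {suc k} k<L =
  cong₂ _+_ (height-cong f≐g (<⇒≤ k<L)) (cong north (f≐g k k<L))

Below : ℕ → (ℕ → Bool) → (ℕ → Bool) → Set
Below L f g = ∀ k → k ≤ L → height f k ≤ height g k

Below-trans : ∀ {L f g h} → Below L f g → Below L g h → Below L f h
Below-trans f≤g g≤h k k≤L = ≤-trans (f≤g k k≤L) (g≤h k k≤L)

Agree⇒Below : ∀ {L f g} → Agree L f g → Below L f g
Agree⇒Below f≐g k k≤L = ≤-reflexive (height-cong f≐g k≤L)

-- Reflection in the anti-diagonal and splicing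

m∸n≡1+m∸1+n : ∀ {m n} → n < m → m ∸ n ≡ suc (m ∸ suc n)
m∸n≡1+m∸1+n {suc m} {zero}  _         = refl
m∸n≡1+m∸1+n {suc m} {suc n} (s≤s n<m) = m∸n≡1+m∸1+n n<m

m∸[1+m∸1+n]≡n : ∀ {m n} → n < m → m ∸ suc (m ∸ suc n) ≡ n
m∸[1+m∸1+n]≡n {m} {n} n<m =
  trans (cong (m ∸_) (sym (m∸n≡1+m∸1+n n<m))) (m∸[m∸n]≡n (<⇒≤ n<m))

m∸1+n<m : ∀ {m n} → n < m → m ∸ suc n < m
m∸1+n<m {m} {n} n<m = subst (_≤ m) (m∸n≡1+m∸1+n n<m) (m∸n≤m m n)

reflect : ℕ → (ℕ → Bool) → ℕ → Bool
reflect L f k = not (f (L ∸ suc k))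

reflect-cong : ∀ {L f g} → Agree L f g → Agree L (reflect L f) (reflect L g)
reflect-cong {L} f≐g i i<L =
  cong not (f≐g (L ∸ suc i) (m∸1+n<m i<L))

reflect-involutive : ∀ {L} f → Agree L (reflect L (reflect L f)) f
reflect-involutive {L} f i i<L =
  trans (not-involutive _) (cong f (m∸[1+m∸1+n]≡n i<L))

private
  north-complement : ∀ k a x → (k + (a + north x)) + north (not x) ≡ suc (k + a)
  north-complement k a true  = trans (+-comm _ 1) (cong (λ b → suc (k + b)) (+-identityʳ a))
  north-complement k a false = trans (+-identityʳ _) (trans (sym (+-assoc k a 1)) (+-comm _ 1))

-- The first k steps of the reflection are the last k steps of f, reversed
-- and with E and N exchanged.
height-reflect : ∀ {L} f {k} → k ≤ L → height (reflect L f) k + height f L ≡ k + height f (L ∸ k)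
height-reflect f {zero}  _   = refl
height-reflect {L} f {suc k} k<L = begin
  (height (reflect L f) k + north (not x)) + height f L
    ≡⟨ xy∙z≈xz∙y (height (reflect L f) k) (north (not x)) (height f L) ⟩
  (height (reflect L f) k + height f L) + north (not x)
    ≡⟨ cong (_+ north (not x)) (height-reflect f (<⇒≤ k<L)) ⟩
  (k + height f (L ∸ k)) + north (not x)
    ≡⟨ cong (λ m → (k + height f m) + north (not x)) (m∸n≡1+m∸1+n k<L) ⟩
  (k + height f (suc (L ∸ suc k))) + north (not x)
    ≡⟨ north-complement k _ x ⟩
  suc k + height f (L ∸ suc k)
    ∎
  where
  open ≡-Reasoning
  x = f (L ∸ suc k)

reflect-mono : ∀ {L f g} → Below L f g → height f L ≡ height g L →
               Below L (reflect L f) (reflect L g)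
reflect-mono {L} {f} {g} f≤g total k k≤L = +-cancelʳ-≤ (height f L) _ _ (begin
  height (reflect L f) k + height f L  ≡⟨ height-reflect f k≤L ⟩
  k + height f (L ∸ k)                 ≤⟨ +-monoʳ-≤ k (f≤g (L ∸ k) (m∸n≤m L k)) ⟩
  k + height g (L ∸ k)                 ≡⟨ sym (height-reflect g k≤L) ⟩
  height (reflect L g) k + height g L  ≡⟨ cong (height (reflect L g) k +_) (sym total) ⟩
  height (reflect L g) k + height f L  ∎)
  where open ≤-Reasoning

Symmetric : ℕ → (ℕ → Bool) → Set
Symmetric L f = Agree L (reflect L f) f

splice : ℕ → (ℕ → Bool) → (ℕ → Bool) → ℕ → Bool
splice n f g k = if does (k <? n) then f k else g k

splice-< : ∀ {n k} f g → k < n → splice n f g k ≡ f k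
splice-< {n} {k} f g k<n rewrite dec-true (k <? n) k<n = refl

splice-≥ : ∀ {n k} f g → n ≤ k → splice n f g k ≡ g k
splice-≥ {n} {k} f g n≤k rewrite dec-false (k <? n) (≤⇒≯ n≤k) = refl

splice-cong : ∀ {L} n {f f′ g g′} → Agree L f f′ → Agree L g g′ →
              Agree L (splice n f g) (splice n f′ g′)
splice-cong n {f} {f′} {g} {g′} f≐ g≐ i i<L with i <? n
... | yes i<n = trans (splice-< f g i<n) (trans (f≐ i i<L) (sym (splice-< f′ g′ i<n)))
... | no  i≮n = trans (splice-≥ f g (≮⇒≥ i≮n)) (trans (g≐ i i<L) (sym (splice-≥ f′ g′ (≮⇒≥ i≮n))))

splice-self : ∀ {L} n f → Agree L (splice n f f) f
splice-self n f i _ with i <? n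
... | yes i<n = splice-< f f i<n
... | no  i≮n = splice-≥ f f (≮⇒≥ i≮n)

height-splice-≤ : ∀ {n k} f g → k ≤ n → height (splice n f g) k ≡ height f k
height-splice-≤ f g k≤n = height-cong (λ i i<k → splice-< f g (≤-trans i<k k≤n)) ≤-refl

height-splice-≥ : ∀ {n k} f g → height f n ≡ height g n → n ≤ k →
                  height (splice n f g) k ≡ height g k
height-splice-≥ {n} f g seam n≤k = go (≤⇒≤′ n≤k)
  where
  go : ∀ {k} → n ≤′ k → height (splice n f g) k ≡ height g k
  go ≤′-refl        = trans (height-splice-≤ {n} f g ≤-refl) seam
  go (≤′-step n≤′k) = cong₂ _+_ (go n≤′k) (cong north (splice-≥ f g (≤′⇒≤ n≤′k)))

splice-mono : ∀ {L} n {f f′ g g′} → Below L f f′ → Below L g g′ →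
              height f n ≡ height g n → height f′ n ≡ height g′ n →
              Below L (splice n f g) (splice n f′ g′)
splice-mono n {f} {f′} {g} {g′} f≤f′ g≤g′ seam seam′ k k≤L with k ≤? n
... | yes k≤n = subst₂ _≤_ (sym (height-splice-≤ f g k≤n)) (sym (height-splice-≤ f′ g′ k≤n)) (f≤f′ k k≤L)
... | no  k≰n = subst₂ _≤_ (sym (height-splice-≥ f g seam n≤k)) (sym (height-splice-≥ f′ g′ seam′ n≤k))
                           (g≤g′ k k≤L)
  where n≤k = <⇒≤ (≰⇒> k≰n)

-- Symmetrization

module Symmetrization (n : ℕ) where

  L : ℕ
  L = n + n

  mirror-≥ : ∀ {k} → k < n → n ≤ L ∸ suc k
  mirror-≥ {k} k<n = subst (_≤ L ∸ suc k) (m+n∸n≡m n n) (∸-monoʳ-≤ L k<n)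

  mirror-< : ∀ {k} → n ≤ k → k < L → L ∸ suc k < n
  mirror-< {k} n≤k k<L = subst (suc (L ∸ suc k) ≤_) (m+n∸n≡m n n)
    (subst (_≤ L ∸ n) (m∸n≡1+m∸1+n k<L) (∸-monoʳ-≤ L n≤k))

  reflect-splice : ∀ f g → Agree L (reflect L (splice n f g)) (splice n (reflect L g) (reflect L f))
  reflect-splice f g i i<L with i <? n
  ... | yes i<n = trans (cong not (splice-≥ f g (mirror-≥ i<n))) (sym (splice-< (reflect L g) (reflect L f) i<n))
  ... | no  i≮n = trans (cong not (splice-< f g (mirror-< (≮⇒≥ i≮n) i<L)))
                        (sym (splice-≥ (reflect L g) (reflect L f) (≮⇒≥ i≮n)))

  symmetric-from-half : ∀ {f} → (∀ i → i < n → reflect L f i ≡ f i) → Symmetric L f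
  symmetric-from-half {f} first i i<L with i <? n
  ... | yes i<n = first i i<n
  ... | no  i≮n = trans (cong not (sym (first (L ∸ suc i) (mirror-< (≮⇒≥ i≮n) i<L))))
                        (reflect-involutive f i i<L)

  symˡ symʳ : (ℕ → Bool) → ℕ → Bool
  symˡ f = splice n f (reflect L f)
  symʳ f = splice n (reflect L f) f

  symmetric-symˡ : ∀ f → Symmetric L (symˡ f)
  symmetric-symˡ f = Agree-trans (reflect-splice f (reflect L f))
    (splice-cong n (reflect-involutive f) (λ _ _ → refl))

  symmetric-symʳ : ∀ f → Symmetric L (symʳ f)
  symmetric-symʳ f = Agree-trans (reflect-splice (reflect L f) f)
    (splice-cong n (λ _ _ → refl) (reflect-involutive f))

  symˡ-fixes-symmetric : ∀ {f} → Symmetric L f → Agree L (symˡ f) f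
  symˡ-fixes-symmetric {f} sf = Agree-trans (splice-cong n (λ _ _ → refl) sf) (splice-self n f)

  symʳ-fixes-symmetric : ∀ {f} → Symmetric L f → Agree L (symʳ f) f
  symʳ-fixes-symmetric {f} sf = Agree-trans (splice-cong n sf (λ _ _ → refl)) (splice-self n f)

  height-reflect-middle : ∀ {f} → height f L ≡ n → height f n ≡ height (reflect L f) n
  height-reflect-middle {f} total = +-cancelʳ-≡ (height f L) _ _ (begin
    height f n + height f L            ≡⟨ cong (height f n +_) total ⟩
    height f n + n                     ≡⟨ +-comm _ n ⟩
    n + height f n                     ≡⟨ cong (λ m → n + height f m) (sym (m+n∸n≡m n n)) ⟩
    n + height f (L ∸ n)               ≡⟨ sym (height-reflect {L} f (m≤n+m n n)) ⟩
    height (reflect L f) n + height f L ∎)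
    where open ≡-Reasoning

  height-reflect-total : ∀ {f} → height f L ≡ n → height (reflect L f) L ≡ n
  height-reflect-total {f} total = +-cancelʳ-≡ n _ _ (begin
    height (reflect L f) L + n           ≡⟨ cong (height (reflect L f) L +_) (sym total) ⟩
    height (reflect L f) L + height f L  ≡⟨ height-reflect {L} f ≤-refl ⟩
    L + height f (L ∸ L)                 ≡⟨ cong (λ m → L + height f m) (n∸n≡0 L) ⟩
    L + 0                                ≡⟨ +-identityʳ L ⟩
    n + n                                ∎)
    where open ≡-Reasoning

  height-symˡ : ∀ {f} → height f L ≡ n → height (symˡ f) L ≡ n
  height-symˡ {f} total =
    trans (height-splice-≥ f (reflect L f) (height-reflect-middle total) (m≤m+n n n)) (height-reflect-total total)

  height-symʳ : ∀ {f} → height f L ≡ n → height (symʳ f) L ≡ n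
  height-symʳ {f} total = trans (height-splice-≥ (reflect L f) f (sym (height-reflect-middle total)) (m≤m+n n n)) total

  symˡ-mono : ∀ {f g} → height f L ≡ n → height g L ≡ n → Below L f g → Below L (symˡ f) (symˡ g)
  symˡ-mono tf tg f≤g = splice-mono n f≤g (reflect-mono f≤g (trans tf (sym tg)))
    (height-reflect-middle tf) (height-reflect-middle tg)

  symʳ-mono : ∀ {f g} → height f L ≡ n → height g L ≡ n → Below L f g → Below L (symʳ f) (symʳ g)
  symʳ-mono tf tg f≤g = splice-mono n (reflect-mono f≤g (trans tf (sym tg))) f≤g
    (sym (height-reflect-middle tf)) (sym (height-reflect-middle tg))

  stays-between : ∀ (σ : (ℕ → Bool) → ℕ → Bool) →
    (∀ {f} → Symmetric L f → Agree L (σ f) f) →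
    (∀ {f g} → height f L ≡ n → height g L ≡ n → Below L f g → Below L (σ f) (σ g)) →
    ∀ {p q r} → Symmetric L p → Symmetric L q → height p L ≡ n → height q L ≡ n → height r L ≡ n →
    Below L p r → Below L r q → Below L p (σ r) × Below L (σ r) q
  stays-between σ fixes mono sp sq tp tq tr p≤r r≤q =
      Below-trans (Agree⇒Below (Agree-sym (fixes sp))) (mono tp tr p≤r)
    , Below-trans (mono tr tq r≤q) (Agree⇒Below (fixes sq))

-- Words as step sequences

step : ∀ {m} → Vec Bool m → ℕ → Bool
step []      _       = true
step (x ∷ v) zero    = x
step (x ∷ v) (suc k) = step v k

lookup≡step : ∀ {m} (v : Vec Bool m) i → lookup v i ≡ step v (toℕ i)
lookup≡step (x ∷ v) Fin.zero    = refl
lookup≡step (x ∷ v) (Fin.suc i) = lookup≡step v i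

word : ∀ {m} → (ℕ → Bool) → Vec Bool m
word g = tabulate (g ∘ toℕ)

lookup-word : ∀ {m} g (i : Fin m) → lookup (word g) i ≡ g (toℕ i)
lookup-word g = lookup∘tabulate (g ∘ toℕ)

step-word : ∀ {m} g → Agree m (step (word {m} g)) g
step-word {m} g i i<m = begin
  step v i                             ≡⟨ cong (step v) (sym (toℕ-fromℕ< i<m)) ⟩
  step v (toℕ (fromℕ< i<m))            ≡⟨ sym (lookup≡step v (fromℕ< i<m)) ⟩
  lookup v (fromℕ< i<m)                ≡⟨ lookup-word g (fromℕ< i<m) ⟩
  g (toℕ (fromℕ< i<m))                 ≡⟨ cong g (toℕ-fromℕ< i<m) ⟩
  g i                                  ∎
  where
  open ≡-Reasoning
  v = word {m} g

reflect-step : ∀ {m} (v : Vec Bool m) i → reflect m (step v) (toℕ i) ≡ not (lookup v (opposite i))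
reflect-step v i = cong not (trans (cong (step v) (sym (opposite-prop i))) (sym (lookup≡step v _)))

countN-cons : ∀ x w → countN (x ∷ w) ≡ north x + countN w
countN-cons true  w = refl
countN-cons false w = refl

countN-take : ∀ {m} (v : Vec Bool m) k → countN (take k (toList v)) ≡ height (step v) (k ⊓ m)
countN-take []      zero    = refl
countN-take []      (suc k) = refl
countN-take (x ∷ v) zero    = refl
countN-take {suc m} (x ∷ v) (suc k) = begin
  countN (x ∷ take k (toList v))       ≡⟨ countN-cons x _ ⟩
  north x + countN (take k (toList v)) ≡⟨ cong (north x +_) (countN-take v k) ⟩
  north x + height (step v) (k ⊓ m)    ≡⟨ sym (height-suc (step (x ∷ v)) (k ⊓ m)) ⟩
  height (step (x ∷ v)) (suc k ⊓ suc m) ∎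
  where open ≡-Reasoning

countN-toList : ∀ {m} (v : Vec Bool m) → countN (toList v) ≡ height (step v) m
countN-toList {m} v = begin
  countN (toList v)                  ≡⟨ cong countN (sym (take-all m (toList v) (≤-reflexive (length-toList v)))) ⟩
  countN (take m (toList v))         ≡⟨ countN-take v m ⟩
  height (step v) (m ⊓ m)            ≡⟨ cong (height (step v)) (⊓-idem m) ⟩
  height (step v) m                  ∎
  where open ≡-Reasoning

countE+countN : ∀ {m} (v : Vec Bool m) → countE (toList v) + countN (toList v) ≡ m
countE+countN []          = refl
countE+countN (true ∷ v)  = cong suc (countE+countN v)
countE+countN (false ∷ v) = trans (+-suc _ _) (cong suc (countE+countN v))

module _ {n : ℕ} where
  open Symmetrization n using (L)

  isLatticePath⇒height : (w : Word n) → IsLatticePath {n} w → height (step w) L ≡ n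
  isLatticePath⇒height w lp = +-cancelˡ-≡ n _ _ (begin
    n + height (step w) L               ≡⟨ cong₂ _+_ (sym lp) (sym (countN-toList w)) ⟩
    countE (toList w) + countN (toList w) ≡⟨ countE+countN w ⟩
    n + n                               ∎)
    where open ≡-Reasoning

  height⇒isLatticePath : (w : Word n) → height (step w) L ≡ n → IsLatticePath {n} w
  height⇒isLatticePath w h = +-cancelʳ-≡ n _ _ (begin
    countE (toList w) + n                 ≡⟨ cong (countE (toList w) +_) (sym (trans (countN-toList w) h)) ⟩
    countE (toList w) + countN (toList w) ≡⟨ countE+countN w ⟩
    n + n                                 ∎)
    where open ≡-Reasoning

  ≤P⇒Below : {p r : Word n} → _≤P_ {n} p r → Below L (step p) (step r)
  ≤P⇒Below {p} {r} p≤r k k≤L =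
    subst₂ _≤_ (trans (countN-take p k) (cong (height (step p)) (m≤n⇒m⊓n≡m k≤L)))
               (trans (countN-take r k) (cong (height (step r)) (m≤n⇒m⊓n≡m k≤L))) (p≤r k)

  Below⇒≤P : {p r : Word n} → Below L (step p) (step r) → _≤P_ {n} p r
  Below⇒≤P {p} {r} p≤r k =
    subst₂ _≤_ (sym (countN-take p k)) (sym (countN-take r k)) (p≤r (k ⊓ L) (m⊓n≤n k L))

  isSymmetric⇒Symmetric : (w : Word n) → IsSymmetric {n} w → Symmetric L (step w)
  isSymmetric⇒Symmetric w sw = Symmetrization.symmetric-from-half n first
    where
    first : ∀ i → i < n → reflect L (step w) i ≡ step w i
    first i i<n = begin
      reflect L (step w) i                 ≡⟨ cong (reflect L (step w)) (sym i≡) ⟩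
      reflect L (step w) (toℕ (j ↑ˡ n))    ≡⟨ reflect-step w (j ↑ˡ n) ⟩
      not (lookup w (opposite (j ↑ˡ n)))   ≡⟨ sym (¬-not (sw j)) ⟩
      lookup w (j ↑ˡ n)                    ≡⟨ lookup≡step w _ ⟩
      step w (toℕ (j ↑ˡ n))                ≡⟨ cong (step w) i≡ ⟩
      step w i                             ∎
      where
      open ≡-Reasoning
      j = fromℕ< i<n
      i≡ = trans (toℕ-↑ˡ j n) (toℕ-fromℕ< i<n)

  Symmetric⇒isSymmetric : (w : Word n) → Symmetric L (step w) → IsSymmetric {n} w
  Symmetric⇒isSymmetric w sw i = subst (lookup w (i ↑ˡ n) ≢_) (not-involutive _) (not-¬ (begin
    lookup w (i ↑ˡ n)                      ≡⟨ lookup≡step w _ ⟩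
    step w (toℕ (i ↑ˡ n))                  ≡⟨ sym (sw _ (toℕ<n (i ↑ˡ n))) ⟩
    reflect L (step w) (toℕ (i ↑ˡ n))      ≡⟨ reflect-step w (i ↑ˡ n) ⟩
    not (lookup w (opposite (i ↑ˡ n)))     ∎))
    where open ≡-Reasoning

  word-feasible : {p q : Word n} {g : ℕ → Bool} →
    Symmetric L g → height g L ≡ n → Below L (step p) g → Below L g (step q) →
    IsFeasibleVecΔ {n} p q (labPosVec {n} (word g))
  word-feasible {g = g} sg total p≤g g≤q =
      word g
    , height⇒isLatticePath (word g) (trans (height-cong (step-word {L} g) ≤-refl) total)
    , Symmetric⇒isSymmetric (word g)
        (Agree-trans (reflect-cong (step-word g)) (Agree-trans sg (Agree-sym (step-word g))))
    , Below⇒≤P (Below-trans p≤g (Agree⇒Below (Agree-sym (step-word g))))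
    , Below⇒≤P (Below-trans (Agree⇒Below (step-word g)) g≤q)
    , λ _ → refl

-- The projection π and convex hulls

private
  ind-midpoint : ∀ a c → ((ind a ℚ.- ind (not c)) ℚ.+ 1ℚ) ℚ.* ½ ≡ ½ ℚ.* ind c ℚ.+ ½ ℚ.* ind a
  ind-midpoint true  true  = refl
  ind-midpoint true  false = refl
  ind-midpoint false true  = refl
  ind-midpoint false false = refl

  ind-half+half : ∀ a → ½ ℚ.* ind a ℚ.+ ½ ℚ.* ind a ≡ ind a
  ind-half+half true  = refl
  ind-half+half false = refl

π-cong : ∀ {n} {y y′ : Fin (n + n) → ℚ} → (∀ k → y k ≡ y′ k) → ∀ j → π {n} y j ≡ π {n} y′ j
π-cong {n} y≡y′ j =
  cong₂ (λ a b → ((a ℚ.- b) ℚ.+ 1ℚ) ℚ.* ½) (y≡y′ (n ↑ʳ j)) (y≡y′ (opposite (n ↑ʳ j)))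

-- The step labelled -(j+1) is the complement of reflect (step r) at n + j.
π-labVec : ∀ {n} (r : Word n) j →
  π {n} (labVec {n} r) j ≡ ½ ℚ.* ind (reflect (n + n) (step r) (n + toℕ j)) ℚ.+ ½ ℚ.* ind (step r (n + toℕ j))
π-labVec {n} r j = begin
  ((ind (lookup r x) ℚ.- ind (lookup r (opposite x))) ℚ.+ 1ℚ) ℚ.* ½
    ≡⟨ cong₂ (λ a b → ((ind a ℚ.- ind b) ℚ.+ 1ℚ) ℚ.* ½) (lookup≡step r x) lookup-opposite ⟩
  ((ind (step r (toℕ x)) ℚ.- ind (not (reflect (n + n) (step r) (toℕ x)))) ℚ.+ 1ℚ) ℚ.* ½
    ≡⟨ ind-midpoint (step r (toℕ x)) (reflect (n + n) (step r) (toℕ x)) ⟩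
  ½ ℚ.* ind (reflect (n + n) (step r) (toℕ x)) ℚ.+ ½ ℚ.* ind (step r (toℕ x))
    ≡⟨ cong (λ k → ½ ℚ.* ind (reflect (n + n) (step r) k) ℚ.+ ½ ℚ.* ind (step r k)) (toℕ-↑ʳ n j) ⟩
  ½ ℚ.* ind (reflect (n + n) (step r) (n + toℕ j)) ℚ.+ ½ ℚ.* ind (step r (n + toℕ j))
    ∎
  where
  open ≡-Reasoning
  x = n ↑ʳ j
  lookup-opposite : lookup r (opposite x) ≡ not (reflect (n + n) (step r) (toℕ x))
  lookup-opposite = trans (sym (not-involutive _)) (cong not (sym (reflect-step r x)))

labPosVec-step : ∀ {n} (r : Word n) j → labPosVec {n} r j ≡ ind (step r (n + toℕ j))
labPosVec-step {n} r j = cong ind (trans (lookup≡step r (n ↑ʳ j)) (cong (step r) (toℕ-↑ʳ n j)))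

module _ {n : ℕ} (r : Word n) where
  open Symmetrization n

  π-labVec≡average : ∀ j → π {n} (labVec {n} r) j ≡
    ½ ℚ.* labPosVec {n} (word (symˡ (step r))) j ℚ.+ ½ ℚ.* labPosVec {n} (word (symʳ (step r))) j
  π-labVec≡average j = trans (π-labVec r j) (sym (cong₂ (λ a b → ½ ℚ.* a ℚ.+ ½ ℚ.* b)
    (trans (at-middle (symˡ (step r))) (cong ind (splice-≥ (step r) (reflect L (step r)) n≤k)))
    (trans (at-middle (symʳ (step r))) (cong ind (splice-≥ (reflect L (step r)) (step r) n≤k)))))
    where
    k = n + toℕ j
    n≤k = m≤m+n n (toℕ j)
    at-middle : ∀ g → labPosVec {n} (word g) j ≡ ind (g k)
    at-middle g = trans (labPosVec-step (word g) j) (cong ind (step-word g k (+-monoʳ-< n (toℕ<n j))))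

  π-labVec-symmetric : IsSymmetric {n} r → ∀ j → π {n} (labVec {n} r) j ≡ labPosVec {n} r j
  π-labVec-symmetric sr j = begin
    π {n} (labVec {n} r) j                                 ≡⟨ π-labVec r j ⟩
    ½ ℚ.* ind (reflect L (step r) k) ℚ.+ ½ ℚ.* ind (step r k)
      ≡⟨ cong (λ b → ½ ℚ.* ind b ℚ.+ ½ ℚ.* ind (step r k))
              (isSymmetric⇒Symmetric r sr k (+-monoʳ-< n (toℕ<n j))) ⟩
    ½ ℚ.* ind (step r k) ℚ.+ ½ ℚ.* ind (step r k)          ≡⟨ ind-half+half (step r k) ⟩
    ind (step r k)                                         ≡⟨ sym (labPosVec-step r j) ⟩
    labPosVec {n} r j                                      ∎
    where
    open ≡-Reasoning
    k = n + toℕ j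

weightSum : ∀ {A : Set} → List (ℚ × A) → ℚ
weightSum cs = sumℚ (map proj₁ cs)

combination : ∀ {d} → List (ℚ × (Fin d → ℚ)) → Fin d → ℚ
combination cs i = sumℚ (map (λ cv → proj₁ cv ℚ.* proj₂ cv i) cs)

private
  open import Data.Rational.Solver using (module +-*-Solver)
  open +-*-Solver

  affine-step : ∀ w a b A B W →
    w ℚ.* (((a ℚ.- b) ℚ.+ 1ℚ) ℚ.* ½) ℚ.+ ((A ℚ.- B) ℚ.+ W) ℚ.* ½
      ≡ (((w ℚ.* a ℚ.+ A) ℚ.- (w ℚ.* b ℚ.+ B)) ℚ.+ (w ℚ.+ W)) ℚ.* ½
  affine-step = solve 6 (λ w a b A B W →
    w :* (((a :- b) :+ con 1ℚ) :* con ½) :+ ((A :- B) :+ W) :* con ½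
      := (((w :* a :+ A) :- (w :* b :+ B)) :+ (w :+ W)) :* con ½) refl

  halves-step : ∀ w a b S →
    w ℚ.* ½ ℚ.* a ℚ.+ (w ℚ.* ½ ℚ.* b ℚ.+ S) ≡ w ℚ.* (½ ℚ.* a ℚ.+ ½ ℚ.* b) ℚ.+ S
  halves-step = solve 4 (λ w a b S →
    w :* con ½ :* a :+ (w :* con ½ :* b :+ S) := w :* (con ½ :* a :+ con ½ :* b) :+ S) refl

  halves-weight : ∀ w S → w ℚ.* ½ ℚ.+ (w ℚ.* ½ ℚ.+ S) ≡ w ℚ.+ S
  halves-weight = solve 2 (λ w S → w :* con ½ :+ (w :* con ½ :+ S) := w :+ S) refl

  nonNeg-half : ∀ {w} → 0ℚ ℚ.≤ w → 0ℚ ℚ.≤ w ℚ.* ½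
  nonNeg-half = *-monoʳ-≤-nonNeg ½

sum-affine : ∀ {X : Set} (a b : X → ℚ) (cs : List (ℚ × X)) →
  sumℚ (map (λ cv → proj₁ cv ℚ.* (((a (proj₂ cv) ℚ.- b (proj₂ cv)) ℚ.+ 1ℚ) ℚ.* ½)) cs)
    ≡ ((sumℚ (map (λ cv → proj₁ cv ℚ.* a (proj₂ cv)) cs)
        ℚ.- sumℚ (map (λ cv → proj₁ cv ℚ.* b (proj₂ cv)) cs)) ℚ.+ weightSum cs) ℚ.* ½
sum-affine a b []             = refl
sum-affine a b ((w , v) ∷ cs) =
  trans (cong (w ℚ.* (((a v ℚ.- b v) ℚ.+ 1ℚ) ℚ.* ½) ℚ.+_) (sum-affine a b cs)) (affine-step w (a v) (b v) _ _ _)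

π-combination : ∀ {n} (cs : List (ℚ × (Fin (n + n) → ℚ))) → weightSum cs ≡ 1ℚ → ∀ j →
  π {n} (combination cs) j ≡ sumℚ (map (λ cv → proj₁ cv ℚ.* π {n} (proj₂ cv) j) cs)
π-combination {n} cs total j =
  trans (cong (λ W → ((combination cs (n ↑ʳ j) ℚ.- combination cs (opposite (n ↑ʳ j))) ℚ.+ W) ℚ.* ½) (sym total))
        (sym (sum-affine (λ v → v (n ↑ʳ j)) (λ v → v (opposite (n ↑ʳ j))) cs))

Weighted : ∀ {d} → ((Fin d → ℚ) → Set) → List (ℚ × (Fin d → ℚ)) → Set
Weighted P = All (λ cv → (0ℚ ℚ.≤ proj₁ cv) × P (proj₂ cv))

module _ {n : ℕ} {S : (Fin (n + n) → ℚ) → Set} {T : (Fin n → ℚ) → Set} where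

  InHull-π-midpoints :
    (∀ {y} → S y → ∃₂ λ t₁ t₂ → T t₁ × T t₂ ×
                                (∀ j → π {n} y j ≡ ½ ℚ.* t₁ j ℚ.+ ½ ℚ.* t₂ j)) →
    ∀ {x} → Image-π {n} (InHull S) x → InHull T x
  InHull-π-midpoints mid {x} (y , (cs , ws , total , y≡) , πy≡x) =
    halve ws , halve-weighted ws , trans (halve-weightSum ws) total , λ j → begin
      combination (halve ws) j                              ≡⟨ halve-combination ws j ⟩
      sumℚ (map (λ cv → proj₁ cv ℚ.* π {n} (proj₂ cv) j) cs) ≡⟨ sym (π-combination cs total j) ⟩
      π {n} (combination cs) j                              ≡⟨ π-cong y≡ j ⟩
      π {n} y j                                             ≡⟨ πy≡x j ⟩
      x j                                                   ∎
    where
    open ≡-Reasoning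
    halve : ∀ {cs} → Weighted S cs → List (ℚ × (Fin n → ℚ))
    halve []                          = []
    halve {(w , _) ∷ _} ((_ , s) ∷ ws) with mid s
    ... | t₁ , t₂ , _ = (w ℚ.* ½ , t₁) ∷ (w ℚ.* ½ , t₂) ∷ halve ws

    halve-weighted : ∀ {cs} (ws : Weighted S cs) → Weighted T (halve ws)
    halve-weighted []               = []
    halve-weighted ((w≥0 , s) ∷ ws) with mid s
    ... | _ , _ , t₁ , t₂ , _ = (nonNeg-half w≥0 , t₁) ∷ (nonNeg-half w≥0 , t₂) ∷ halve-weighted ws

    halve-weightSum : ∀ {cs} (ws : Weighted S cs) → weightSum (halve ws) ≡ weightSum cs
    halve-weightSum []                             = refl
    halve-weightSum {(w , _) ∷ _} ((_ , s) ∷ ws) with mid s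
    ... | _ = trans (halves-weight w _) (cong (w ℚ.+_) (halve-weightSum ws))

    halve-combination : ∀ {cs} (ws : Weighted S cs) j →
      combination (halve ws) j ≡ sumℚ (map (λ cv → proj₁ cv ℚ.* π {n} (proj₂ cv) j) cs)
    halve-combination []                           j = refl
    halve-combination {(w , _) ∷ _} ((_ , s) ∷ ws) j with mid s
    ... | _ , _ , _ , _ , average =
      trans (halves-step w _ _ _)
            (cong₂ ℚ._+_ (cong (w ℚ.*_) (sym (average j))) (halve-combination ws j))

  InHull-π-lift :
    (∀ {t} → T t → Σ (Fin (n + n) → ℚ) λ y → S y × (∀ j → π {n} y j ≡ t j)) →
    ∀ {x} → InHull T x → Image-π {n} (InHull S) x
  InHull-π-lift lift {x} (cs , ws , total , combination≡x) =
    combination (lifted ws) ,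
    (lifted ws , lifted-weighted ws , trans (lifted-weightSum ws) total , λ _ → refl) ,
    λ j → begin
      π {n} (combination (lifted ws)) j
        ≡⟨ π-combination (lifted ws) (trans (lifted-weightSum ws) total) j ⟩
      sumℚ (map (λ cv → proj₁ cv ℚ.* π {n} (proj₂ cv) j) (lifted ws))
        ≡⟨ lifted-combination ws j ⟩
      combination cs j
        ≡⟨ combination≡x j ⟩
      x j ∎
    where
    open ≡-Reasoning
    lifted : ∀ {cs} → Weighted T cs → List (ℚ × (Fin (n + n) → ℚ))
    lifted []                          = []
    lifted {(w , _) ∷ _} ((_ , t) ∷ ws) = (w , proj₁ (lift t)) ∷ lifted ws

    lifted-weighted : ∀ {cs} (ws : Weighted T cs) → Weighted S (lifted ws)
    lifted-weighted []               = []
    lifted-weighted ((w≥0 , t) ∷ ws) = (w≥0 , proj₁ (proj₂ (lift t))) ∷ lifted-weighted ws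

    lifted-weightSum : ∀ {cs} (ws : Weighted T cs) → weightSum (lifted ws) ≡ weightSum cs
    lifted-weightSum []                          = refl
    lifted-weightSum {(w , _) ∷ _} (_ ∷ ws) = cong (w ℚ.+_) (lifted-weightSum ws)

    lifted-combination : ∀ {cs} (ws : Weighted T cs) j →
      sumℚ (map (λ cv → proj₁ cv ℚ.* π {n} (proj₂ cv) j) (lifted ws)) ≡ combination cs j
    lifted-combination []                           j = refl
    lifted-combination {(w , _) ∷ _} ((_ , t) ∷ ws) j =
      cong₂ ℚ._+_ (cong (w ℚ.*_) (proj₂ (proj₂ (lift t)) j)) (lifted-combination ws j)

-- Bases and feasible sets of [p,q]

module Interval {n : ℕ} (p q : Word n)
                (lp : IsLatticePath {n} p) (lq : IsLatticePath {n} q)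
                (sp : IsSymmetric {n} p) (sq : IsSymmetric {n} q) where
  open Symmetrization n

  symmetrize-feasible : ∀ σ r →
    (∀ {f} → Symmetric L (σ f)) →
    (∀ {f} → height f L ≡ n → height (σ f) L ≡ n) →
    (∀ {f} → Symmetric L f → Agree L (σ f) f) →
    (∀ {f g} → height f L ≡ n → height g L ≡ n → Below L f g → Below L (σ f) (σ g)) →
    IsLatticePath {n} r → _≤P_ {n} p r → _≤P_ {n} r q →
    IsFeasibleVecΔ {n} p q (labPosVec {n} (word (σ (step r))))
  symmetrize-feasible σ r symmetric total fixes mono lr p≤r r≤q =
    let p≤σr , σr≤q = stays-between σ fixes mono
                        (isSymmetric⇒Symmetric p sp) (isSymmetric⇒Symmetric q sq)
                        (isLatticePath⇒height p lp) (isLatticePath⇒height q lq) (isLatticePath⇒height r lr)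
                        (≤P⇒Below {n} {p} {r} p≤r) (≤P⇒Below {n} {r} {q} r≤q)
    in word-feasible {n} {p} {q} symmetric (total (isLatticePath⇒height r lr)) p≤σr σr≤q

  π-basis-midpoint : ∀ {y} → IsBasisVecM {n} p q y →
    ∃₂ λ t₁ t₂ → IsFeasibleVecΔ {n} p q t₁ × IsFeasibleVecΔ {n} p q t₂ ×
                 (∀ j → π {n} y j ≡ ½ ℚ.* t₁ j ℚ.+ ½ ℚ.* t₂ j)
  π-basis-midpoint (r , lr , p≤r , r≤q , y≡) =
      labPosVec {n} (word (symˡ (step r))) , labPosVec {n} (word (symʳ (step r)))
    , symmetrize-feasible symˡ r (symmetric-symˡ _) height-symˡ symˡ-fixes-symmetric symˡ-mono lr p≤r r≤q
    , symmetrize-feasible symʳ r (symmetric-symʳ _) height-symʳ symʳ-fixes-symmetric symʳ-mono lr p≤r r≤q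
    , λ j → trans (π-cong y≡ j) (π-labVec≡average r j)

  π-feasible-lift : ∀ {t} → IsFeasibleVecΔ {n} p q t →
    Σ (Fin (n + n) → ℚ) λ y → IsBasisVecM {n} p q y × (∀ j → π {n} y j ≡ t j)
  π-feasible-lift (r , lr , sr , p≤r , r≤q , t≡) =
      labVec {n} r , (r , lr , p≤r , r≤q , λ _ → refl)
    , λ j → trans (π-labVec-symmetric r sr j) (sym (t≡ j))

proposition3p11 : (n : ℕ) (p q : Word n) →
    IsLatticePath {n} p → IsLatticePath {n} q → IsSymmetric {n} p → IsSymmetric {n} q →
    _≤P_ {n} p q → (x : Fin n → ℚ) →
    (Image-π {n} (PM {n} p q) x → PΔ {n} p q x) × (PΔ {n} p q x → Image-π {n} (PM {n} p q) x)
proposition3p11 n p q lp lq sp sq _ x =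
  InHull-π-midpoints π-basis-midpoint , InHull-π-lift π-feasible-lift
  where open Interval p q lp lq sp sq
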